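{- Let $k \ge 2$ be an integer, and let $G$ be a graph of order $n$. If $\beta^k(G) \ge 1$, then $\kappa(G) \ge \frac{\beta^k(G) - 1}{\beta^k(G) + 1}\, n$.
   Context: All graphs are finite and simple. The vertex connectivity $\kappa(G)$ is the minimum number of vertices whose removal disconnects $G$ or reduces it to a single vertex. For $S\subseteq V(G)$, $\Lambda^k_G(S)$ is the set of vertices with at least $k$ neighbors in $S$, and $\beta^k(G)=\min\{|\Lambda^k_G(S)|/|S| : S\subseteq V(G),\ |S|\ge k,\ \Lambda^k_G(S)\ne V(G)\}$, with $\beta^k(G)=0$ if $|V(G)|<k$. -}

module Defs where

open import Data.Nat as ℕ using (ℕ; zero; suc; _≤_; _<_; _≤ᵇ_)
open import Data.Integer using (+_)
open import Data.Rational as ℚ using (ℚ; 0ℚ)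
open import Data.Bool using (Bool; true; false; _∧_)
open import Data.Fin using (Fin)
open import Data.Fin.Subset using (Subset; ∣_∣; ∁; ⊤; _∉_)
open import Data.Vec using (tabulate; lookup)
open import Data.Product using (Σ; _×_; ∃-syntax)
open import Data.Sum using (_⊎_)
open import Relation.Nullary using (¬_)
open import Relation.Binary.PropositionalEquality using (_≡_; _≢_)

record Graph (n : ℕ) : Set where
  field
    adj    : Fin n → Fin n → Bool
    sym    : ∀ u v → adj u v ≡ adj v u
    irrefl : ∀ v → adj v v ≡ false
open Graph public

degIn : ∀ {n} → Graph n → Subset n → Fin n → ℕ
degIn G S v = ∣ tabulate (λ u → lookup S u ∧ adj G v u) ∣

Λ : ∀ {n} → ℕ → Graph n → Subset n → Subset n
Λ k G S = tabulate (λ v → k ≤ᵇ degIn G S v)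

-- the rational a / b (only used with b ≥ 1; value 0 for b = 0)
ratio : ℕ → ℕ → ℚ
ratio a zero    = 0ℚ
ratio a (suc b) = (+ a) ℚ./ suc b

Admissible : ∀ {n} → ℕ → Graph n → Subset n → Set
Admissible k G S = k ≤ ∣ S ∣ × Λ k G S ≢ ⊤

IsBeta : ∀ {n} → ℕ → Graph n → ℚ → Set
IsBeta {n} k G b =
  (n < k × b ≡ 0ℚ)
  ⊎ (k ≤ n
     × (∃[ S ] (Admissible k G S × b ≡ ratio ∣ Λ k G S ∣ ∣ S ∣))
     × (∀ S → Admissible k G S → b ℚ.≤ ratio ∣ Λ k G S ∣ ∣ S ∣))

data Reach {n} (G : Graph n) (X : Subset n) (u : Fin n) : Fin n → Set where
  here : u ∉ X → Reach G X u u
  step : ∀ {v w} → Reach G X u v → adj G v w ≡ true → w ∉ X → Reach G X u w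

Separating : ∀ {n} → Graph n → Subset n → Set
Separating G X =
  ∣ ∁ X ∣ ≤ 1 ⊎ (∃[ u ] ∃[ v ] (u ∉ X × v ∉ X × ¬ Reach G X u v))

IsKappa : ∀ {n} → Graph n → ℕ → Set
IsKappa G c =
  (∃[ X ] (Separating G X × ∣ X ∣ ≡ c)) × (∀ X → Separating G X → c ≤ ∣ X ∣)

{-# OPTIONS --safe #-}

-- Let X be a minimum separating set and c = |X|. If G - X has at most one vertex, then n - c ≤ 1
-- and every admissible S satisfies |Λ^k(S)| (n - c) ≤ (n + c) |S|. Otherwise split V(G) - X into
-- the vertices A reachable in G - X from one vertex and the rest B; there are no A-B edges, and
-- after swapping |A| ≤ |B|. If k ≤ |B| + c, take S = B plus k - |B| vertices of X: a vertex of A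
-- has fewer than k neighbours in S, so S is admissible and Λ^k(S) ⊆ X ∪ B, while n - c ≤ 2|B|
-- and |B| ≤ |S|; this again gives |Λ^k(S)| (n - c) ≤ (n + c) |S|. If |B| + c < k, then S = V(G)
-- works, as a vertex of B has fewer than k neighbours. Minimality of β^k(G) then yields
-- β (n - c) ≤ n + c, which is the claim rearranged.

module Submission where

open import Defs hiding (sym)

module SubsetCounting where

  open import Data.Nat using (zero; suc; _+_; _≤_; z≤n; s≤s)
  open import Data.Nat.Properties using (+-suc; ≤-trans; n≤1+n; +-monoʳ-≤)
  open import Data.Fin using (zero)
  open import Data.Fin.Subset
  open import Data.Fin.Subset.Properties using (drop-∷-Empty; s⊆s; ⊥⊆; ∣⊥∣≡0)
  open import Data.Vec using (_∷_; []; here)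
  open import Data.Product using (∃; _×_; _,_)
  open import Relation.Nullary using (contradiction)
  open import Relation.Binary.PropositionalEquality using (_≡_; refl; cong; trans; sym)

  ∣p∪q∣≤∣p∣+∣q∣ : ∀ {n} (p q : Subset n) → ∣ p ∪ q ∣ ≤ ∣ p ∣ + ∣ q ∣
  ∣p∪q∣≤∣p∣+∣q∣ []            []            = z≤n
  ∣p∪q∣≤∣p∣+∣q∣ (inside ∷ p)  (inside ∷ q)  =
    s≤s (≤-trans (∣p∪q∣≤∣p∣+∣q∣ p q) (+-monoʳ-≤ ∣ p ∣ (n≤1+n ∣ q ∣)))
  ∣p∪q∣≤∣p∣+∣q∣ (inside ∷ p)  (outside ∷ q) = s≤s (∣p∪q∣≤∣p∣+∣q∣ p q)
  ∣p∪q∣≤∣p∣+∣q∣ (outside ∷ p) (inside ∷ q)  rewrite +-suc ∣ p ∣ ∣ q ∣ = s≤s (∣p∪q∣≤∣p∣+∣q∣ p q)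
  ∣p∪q∣≤∣p∣+∣q∣ (outside ∷ p) (outside ∷ q) = ∣p∪q∣≤∣p∣+∣q∣ p q

  ∣p∪q∣≡∣p∣+∣q∣ : ∀ {n} (p q : Subset n) → Empty (p ∩ q) → ∣ p ∪ q ∣ ≡ ∣ p ∣ + ∣ q ∣
  ∣p∪q∣≡∣p∣+∣q∣ []            []            _     = refl
  ∣p∪q∣≡∣p∣+∣q∣ (inside ∷ p)  (inside ∷ q)  p∩q=∅ = contradiction (zero , here) p∩q=∅
  ∣p∪q∣≡∣p∣+∣q∣ (inside ∷ p)  (outside ∷ q) p∩q=∅ =
    cong suc (∣p∪q∣≡∣p∣+∣q∣ p q (drop-∷-Empty p∩q=∅))
  ∣p∪q∣≡∣p∣+∣q∣ (outside ∷ p) (inside ∷ q)  p∩q=∅ =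
    trans (cong suc (∣p∪q∣≡∣p∣+∣q∣ p q (drop-∷-Empty p∩q=∅))) (sym (+-suc ∣ p ∣ ∣ q ∣))
  ∣p∪q∣≡∣p∣+∣q∣ (outside ∷ p) (outside ∷ q) p∩q=∅ = ∣p∪q∣≡∣p∣+∣q∣ p q (drop-∷-Empty p∩q=∅)

  ⊆-of-size : ∀ {n} m (p : Subset n) → m ≤ ∣ p ∣ → ∃ λ q → q ⊆ p × ∣ q ∣ ≡ m
  ⊆-of-size {n} zero    p             _       = ⊥ , ⊥⊆ , ∣⊥∣≡0 n
  ⊆-of-size     (suc m) (inside ∷ p)  (s≤s h) with ⊆-of-size m p h
  ... | q , q⊆p , ∣q∣≡m = inside ∷ q , s⊆s q⊆p , cong suc ∣q∣≡m
  ⊆-of-size     (suc m) (outside ∷ p) h       with ⊆-of-size (suc m) p h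
  ... | q , q⊆p , ∣q∣≡m = outside ∷ q , s⊆s q⊆p , ∣q∣≡m

module NatToRational where

  open import Data.Nat as ℕ using (ℕ; suc; _∸_)
  import Data.Nat.Properties as ℕ
  open import Data.Integer as ℤ using (+_)
  import Data.Integer.Properties as ℤ
  open import Data.Rational
  open import Data.Rational.Properties
  open import Data.Rational.Solver using (module +-*-Solver)
  open import Data.Rational.Unnormalised as ℚᵘ using (mkℚᵘ; *≡*)
  import Data.Rational.Unnormalised.Properties as ℚᵘ
  open import Data.Product using (_,_)
  open import Relation.Binary.PropositionalEquality

  fromℚᵘ-homo-+ : ∀ p q → fromℚᵘ (p ℚᵘ.+ q) ≡ fromℚᵘ p + fromℚᵘ q
  fromℚᵘ-homo-+ p q = toℚᵘ-injective (ℚᵘ.≃-trans (toℚᵘ-fromℚᵘ (p ℚᵘ.+ q)) (ℚᵘ.≃-sym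
    (ℚᵘ.≃-trans (toℚᵘ-homo-+ (fromℚᵘ p) (fromℚᵘ q)) (ℚᵘ.+-cong (toℚᵘ-fromℚᵘ p) (toℚᵘ-fromℚᵘ q)))))

  fromℚᵘ-homo-* : ∀ p q → fromℚᵘ (p ℚᵘ.* q) ≡ fromℚᵘ p * fromℚᵘ q
  fromℚᵘ-homo-* p q = toℚᵘ-injective (ℚᵘ.≃-trans (toℚᵘ-fromℚᵘ (p ℚᵘ.* q)) (ℚᵘ.≃-sym
    (ℚᵘ.≃-trans (toℚᵘ-homo-* (fromℚᵘ p) (fromℚᵘ q)) (ℚᵘ.*-cong (toℚᵘ-fromℚᵘ p) (toℚᵘ-fromℚᵘ q)))))

  mkℚᵘ-+ : ∀ a b → mkℚᵘ (+ (a ℕ.+ b)) 0 ℚᵘ.≃ mkℚᵘ (+ a) 0 ℚᵘ.+ mkℚᵘ (+ b) 0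
  mkℚᵘ-+ a b = *≡* (begin
    + (a ℕ.+ b) ℤ.* + 1                    ≡⟨ ℤ.*-identityʳ _ ⟩
    + (a ℕ.+ b)                            ≡⟨ ℤ.pos-+ a b ⟩
    + a ℤ.+ + b                            ≡⟨ cong₂ ℤ._+_ (ℤ.*-identityʳ (+ a)) (ℤ.*-identityʳ (+ b)) ⟨
    + a ℤ.* + 1 ℤ.+ + b ℤ.* + 1            ≡⟨ ℤ.*-identityʳ _ ⟨
    (+ a ℤ.* + 1 ℤ.+ + b ℤ.* + 1) ℤ.* + 1  ∎)
    where open ≡-Reasoning

  mkℚᵘ-* : ∀ a b → mkℚᵘ (+ (a ℕ.* b)) 0 ℚᵘ.≃ mkℚᵘ (+ a) 0 ℚᵘ.* mkℚᵘ (+ b) 0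
  mkℚᵘ-* a b = *≡* (cong (ℤ._* + 1) (ℤ.pos-* a b))

  mkℚᵘ-*-denominator : ∀ a d → mkℚᵘ (+ a) d ℚᵘ.* mkℚᵘ (+ suc d) 0 ℚᵘ.≃ mkℚᵘ (+ a) 0
  mkℚᵘ-*-denominator a d =
    *≡* (trans (ℤ.*-identityʳ _) (cong (+ a ℤ.*_) (sym (ℤ.*-identityʳ (+ suc d)))))

  ι : ℕ → ℚ
  ι m = + m / 1

  ι-+ : ∀ a b → ι (a ℕ.+ b) ≡ ι a + ι b
  ι-+ a b = trans (fromℚᵘ-cong (mkℚᵘ-+ a b)) (fromℚᵘ-homo-+ (mkℚᵘ (+ a) 0) (mkℚᵘ (+ b) 0))

  ι-* : ∀ a b → ι (a ℕ.* b) ≡ ι a * ι b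
  ι-* a b = trans (fromℚᵘ-cong (mkℚᵘ-* a b)) (fromℚᵘ-homo-* (mkℚᵘ (+ a) 0) (mkℚᵘ (+ b) 0))

  ratio-*-ι : ∀ a d → ratio a (suc d) * ι (suc d) ≡ ι a
  ratio-*-ι a d =
    trans (sym (fromℚᵘ-homo-* (mkℚᵘ (+ a) d) (mkℚᵘ (+ suc d) 0))) (fromℚᵘ-cong (mkℚᵘ-*-denominator a d))

  ι-nonNeg : ∀ m → NonNegative (ι m)
  ι-nonNeg m = normalize-nonNeg m 1

  ι-pos : ∀ m → Positive (ι (suc m))
  ι-pos m = normalize-pos (suc m) 1

  ι-mono-≤ : ∀ {a b} → a ℕ.≤ b → ι a ≤ ι b
  ι-mono-≤ {a} a≤b with ℕ.m≤n⇒∃[o]m+o≡n a≤b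
  ... | o , refl = begin
    ι a          ≡⟨ +-identityʳ (ι a) ⟨
    ι a + 0ℚ     ≤⟨ +-monoʳ-≤ (ι a) (nonNegative⁻¹ (ι o) {{ι-nonNeg o}}) ⟩
    ι a + ι o    ≡⟨ ι-+ a o ⟨
    ι (a ℕ.+ o)  ∎
    where open ≤-Reasoning

  ≤ratio⇒*ι≤ι : ∀ {b} l {s} d m → 0 ℕ.< s → b ≤ ratio l s → l ℕ.* d ℕ.≤ m ℕ.* s → b * ι d ≤ ι m
  ≤ratio⇒*ι≤ι {b} l {suc s} d m _ b≤l/s ld≤ms = begin
    b * ι d         ≤⟨ *-monoʳ-≤-nonNeg (ι d) {{ι-nonNeg d}} b≤l/s ⟩
    ratio l s′ * ι d ≤⟨ *-cancelʳ-≤-pos (ι s′) {{ι-pos s}} scaled ⟩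
    ι m             ∎
    where
    open ≤-Reasoning
    s′ = suc s
    scaled : ratio l s′ * ι d * ι s′ ≤ ι m * ι s′
    scaled = begin
      ratio l s′ * ι d * ι s′    ≡⟨ *-assoc (ratio l s′) (ι d) (ι s′) ⟩
      ratio l s′ * (ι d * ι s′)  ≡⟨ cong (ratio l s′ *_) (*-comm (ι d) (ι s′)) ⟩
      ratio l s′ * (ι s′ * ι d)  ≡⟨ *-assoc (ratio l s′) (ι s′) (ι d) ⟨
      ratio l s′ * ι s′ * ι d    ≡⟨ cong (_* ι d) (ratio-*-ι l s) ⟩
      ι l * ι d                  ≡⟨ ι-* l d ⟨
      ι (l ℕ.* d)                ≤⟨ ι-mono-≤ ld≤ms ⟩
      ι (m ℕ.* s′)               ≡⟨ ι-* m s′ ⟩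
      ι m * ι s′                 ∎

  [b-1]n≤[b+1]c : ∀ b {n c} → c ℕ.≤ n → b * ι (n ∸ c) ≤ ι (n ℕ.+ c) →
                  (b - 1ℚ) * ι n ≤ (b + 1ℚ) * ι c
  [b-1]n≤[b+1]c b {n} {c} c≤n b[n-c]≤n+c = begin
    (b - 1ℚ) * ι n                     ≡⟨ cong ((b - 1ℚ) *_) ιn≡ιc+ιd ⟩
    (b - 1ℚ) * (ι c + ι d)             ≡⟨ solve 3 (λ B C D → (B :- con 1ℚ) :* (C :+ D)
                                                     := B :* D :+ (B :* C :- (C :+ D))) refl b (ι c) (ι d) ⟩
    b * ι d + (b * ι c - (ι c + ι d))  ≡⟨ cong (λ t → b * ι d + (b * ι c - t)) ιn≡ιc+ιd ⟨
    b * ι d + r                        ≤⟨ +-monoˡ-≤ r b[n-c]≤n+c ⟩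
    ι (n ℕ.+ c) + r                    ≡⟨ cong (_+ r) (ι-+ n c) ⟩
    ι n + ι c + r                      ≡⟨ solve 3 (λ B C N → N :+ C :+ (B :* C :- N)
                                                     := (B :+ con 1ℚ) :* C) refl b (ι c) (ι n) ⟩
    (b + 1ℚ) * ι c                     ∎
    where
    open ≤-Reasoning
    open +-*-Solver
    d = n ∸ c
    r = b * ι c - ι n
    ιn≡ιc+ιd : ι n ≡ ι c + ι d
    ιn≡ιc+ιd = trans (cong ι (sym (ℕ.m+[n∸m]≡n c≤n))) (ι-+ c d)

module Expansion where

  open SubsetCounting
  open import Data.Bool using (Bool; true; false; _∧_)
  open import Data.Bool.Properties using (T-≡)
  open import Data.Nat using (ℕ; suc; _+_; _*_; _∸_; _≤_; _<_; s≤s; z≤n)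
  open import Data.Nat.Properties
  open import Data.Nat.Solver using (module +-*-Solver)
  open import Data.Fin using (Fin)
  open import Data.Fin.Properties using (sequence)
  open import Data.Fin.Subset
  open import Data.Fin.Subset.Properties
  open import Data.Vec using (tabulate; lookup)
  open import Data.Vec.Properties using (lookup∘tabulate; []=⇒lookup; lookup⇒[]=)
  open import Data.Product using (∃-syntax; _×_; _,_)
  open import Data.Sum as Sum using (_⊎_; inj₁; inj₂; [_,_]′)
  open import Effect.Monad using (RawMonad)
  open import Function using (_∘_; Equivalence)
  open import Relation.Nullary using (¬_; Dec; yes; no; does; contradiction)
  open import Relation.Nullary.Decidable using (¬¬-excluded-middle; dec-true)
  open import Relation.Nullary.Negation using (¬¬-Monad; ¬¬-map)
  open import Relation.Binary.PropositionalEquality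

  ∧≡true⁻ : ∀ {x y} → x ∧ y ≡ true → x ≡ true × y ≡ true
  ∧≡true⁻ {true} refl = refl , refl

  ∈tabulate⁻ : ∀ {n} {f : Fin n → Bool} {i} → i ∈ tabulate f → f i ≡ true
  ∈tabulate⁻ {f = f} {i} i∈ = trans (sym (lookup∘tabulate f i)) ([]=⇒lookup i∈)

  ∈tabulate⁺ : ∀ {n} {f : Fin n → Bool} {i} → f i ≡ true → i ∈ tabulate f
  ∈tabulate⁺ {f = f} {i} fi = lookup⇒[]= i (tabulate f) (trans (lookup∘tabulate f i) fi)

  degIn-≤ : ∀ {n} (G : Graph n) S {T v} →
            (∀ {u} → u ∈ S → adj G v u ≡ true → u ∈ T) → degIn G S v ≤ ∣ T ∣
  degIn-≤ G S {T} {v} nbr∈T = p⊆q⇒∣p∣≤∣q∣ nbrIn-S∈T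
    where
    nbrIn-S∈T : ∀ {u} → u ∈ tabulate (λ u → lookup S u ∧ adj G v u) → u ∈ T
    nbrIn-S∈T {u} u∈ with ∧≡true⁻ (∈tabulate⁻ u∈)
    ... | u∈S , vu = nbr∈T (lookup⇒[]= u S u∈S) vu

  ∈Λ⁻ : ∀ {n} k (G : Graph n) S {v} → v ∈ Λ k G S → k ≤ degIn G S v
  ∈Λ⁻ k G S v∈Λ = ≤ᵇ⇒≤ k _ (Equivalence.from T-≡ (∈tabulate⁻ v∈Λ))

  Λ≢⊤ : ∀ {n} k (G : Graph n) S {v} → degIn G S v < k → Λ k G S ≢ ⊤
  Λ≢⊤ k G S {v} deg<k Λ≡⊤ = <⇒≱ deg<k (∈Λ⁻ k G S (subst (v ∈_) (sym Λ≡⊤) ∈⊤))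

  LowExpansionSet : ∀ {n} → ℕ → Graph n → ℕ → Set
  LowExpansionSet {n} k G c = ∃[ S ] (Admissible k G S × ∣ Λ k G S ∣ * (n ∸ c) ≤ (n + c) * ∣ S ∣)

  lowExpansion-if-n∸c≤∣S∣ : ∀ {n k} (G : Graph n) c S →
                            Admissible k G S → n ∸ c ≤ ∣ S ∣ → LowExpansionSet k G c
  lowExpansion-if-n∸c≤∣S∣ {n} {k} G c S adm n∸c≤∣S∣ = S , adm , (begin
    ∣ Λ k G S ∣ * (n ∸ c)  ≤⟨ *-mono-≤ (∣p∣≤n (Λ k G S)) n∸c≤∣S∣ ⟩
    n * ∣ S ∣              ≤⟨ *-monoˡ-≤ ∣ S ∣ (m≤m+n n c) ⟩
    (n + c) * ∣ S ∣        ∎)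
    where open ≤-Reasoning

  m∸n<m : ∀ {m n} → 0 < m → 0 < n → m ∸ n < m
  m∸n<m {suc m} {suc n} _ _ = s≤s (m∸n≤m m n)

  l[n∸c]≤[n+c]s : ∀ {n c q s} l → c ≤ n → l ≤ c + q → n ∸ c ≤ q + q → q ≤ s →
                  l * (n ∸ c) ≤ (n + c) * s
  l[n∸c]≤[n+c]s {n} {c} {q} {s} l c≤n l≤c+q n∸c≤2q q≤s = begin
    l * d                ≤⟨ *-monoˡ-≤ d l≤c+q ⟩
    (c + q) * d          ≡⟨ *-distribʳ-+ d c q ⟩
    c * d + q * d        ≤⟨ +-monoˡ-≤ (q * d) (*-monoʳ-≤ c n∸c≤2q) ⟩
    c * (q + q) + q * d  ≡⟨ solve 3 (λ c q d → c :* (q :+ q) :+ q :* d := (c :+ d :+ c) :* q) refl c q d ⟩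
    (c + d + c) * q      ≡⟨ cong (λ t → (t + c) * q) (m+[n∸m]≡n c≤n) ⟩
    (n + c) * q          ≤⟨ *-monoʳ-≤ (n + c) q≤s ⟩
    (n + c) * s          ∎
    where
    open ≤-Reasoning
    open +-*-Solver
    d = n ∸ c

  record Separation {n} (G : Graph n) (X : Subset n) : Set where
    field
      A B        : Subset n
      a b        : Fin n
      a∈A        : a ∈ A
      b∈B        : b ∈ B
      A-avoids-X : ∀ {x} → x ∈ A → x ∉ X
      B-avoids-X : ∀ {x} → x ∈ B → x ∉ X
      covers     : ∀ x → x ∈ X ⊎ x ∈ A ⊎ x ∈ B
      no-edge    : ∀ {x y} → x ∈ A → y ∈ B → adj G x y ≡ false

  swap : ∀ {n} {G : Graph n} {X} → Separation G X → Separation G X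
  swap {G = G} s = record
    { A = B ; B = A ; a = b ; b = a ; a∈A = b∈B ; b∈B = a∈A
    ; A-avoids-X = B-avoids-X ; B-avoids-X = A-avoids-X
    ; covers = Sum.map₂ Sum.swap ∘ covers
    ; no-edge = λ {x} {y} x∈B y∈A → trans (Graph.sym G x y) (no-edge y∈A x∈B)
    }
    where open Separation s

  module _ {n} {G : Graph n} {X : Subset n} (s : Separation G X) where

    open Separation s

    n∸∣X∣≤∣A∣+∣B∣ : n ∸ ∣ X ∣ ≤ ∣ A ∣ + ∣ B ∣
    n∸∣X∣≤∣A∣+∣B∣ = m≤n+o⇒m∸n≤o n ∣ X ∣ (begin
      n                      ≡⟨ ∣⊤∣≡n n ⟨
      ∣ ⊤ {n} ∣              ≤⟨ p⊆q⇒∣p∣≤∣q∣ {p = ⊤} (λ {x} _ → x∈p∪q⁺ (Sum.map₂ x∈p∪q⁺ (covers x))) ⟩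
      ∣ X ∪ A ∪ B ∣          ≤⟨ ∣p∪q∣≤∣p∣+∣q∣ X (A ∪ B) ⟩
      ∣ X ∣ + ∣ A ∪ B ∣      ≤⟨ +-monoʳ-≤ ∣ X ∣ (∣p∪q∣≤∣p∣+∣q∣ A B) ⟩
      ∣ X ∣ + (∣ A ∣ + ∣ B ∣) ∎)
      where open ≤-Reasoning

    nbr-of-B∈X∪B : ∀ {y u} → y ∈ B → adj G y u ≡ true → u ∈ X ∪ B
    nbr-of-B∈X∪B {y} {u} y∈B yu with covers u
    ... | inj₁ u∈X        = x∈p∪q⁺ (inj₁ u∈X)
    ... | inj₂ (inj₂ u∈B) = x∈p∪q⁺ (inj₂ u∈B)
    ... | inj₂ (inj₁ u∈A) with () ← trans (sym yu) (trans (Graph.sym G y u) (no-edge u∈A y∈B))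

    lowExpansion-if-∣B∣+∣X∣<k : ∀ {k} → k ≤ n → ∣ B ∣ + ∣ X ∣ < k → LowExpansionSet k G ∣ X ∣
    lowExpansion-if-∣B∣+∣X∣<k {k} k≤n ∣B∣+∣X∣<k =
      lowExpansion-if-n∸c≤∣S∣ G ∣ X ∣ ⊤ (k≤∣⊤∣ , Λ≢⊤ k G ⊤ deg<k)
        (subst (n ∸ ∣ X ∣ ≤_) (sym (∣⊤∣≡n n)) (m∸n≤m n ∣ X ∣))
      where
      k≤∣⊤∣ : k ≤ ∣ ⊤ {n} ∣
      k≤∣⊤∣ = subst (k ≤_) (sym (∣⊤∣≡n n)) k≤n
      deg<k : degIn G ⊤ b < k
      deg<k = begin-strict
        degIn G ⊤ b    ≤⟨ degIn-≤ G ⊤ (λ _ → nbr-of-B∈X∪B b∈B) ⟩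
        ∣ X ∪ B ∣      ≤⟨ ∣p∪q∣≤∣p∣+∣q∣ X B ⟩
        ∣ X ∣ + ∣ B ∣  ≡⟨ +-comm ∣ X ∣ ∣ B ∣ ⟩
        ∣ B ∣ + ∣ X ∣  <⟨ ∣B∣+∣X∣<k ⟩
        k              ∎
        where open ≤-Reasoning

    lowExpansion-if-k≤∣B∣+∣X∣ : ∀ {k} → 0 < k → ∣ A ∣ ≤ ∣ B ∣ → k ≤ ∣ B ∣ + ∣ X ∣ →
                                LowExpansionSet k G ∣ X ∣
    lowExpansion-if-k≤∣B∣+∣X∣ {k} 0<k ∣A∣≤∣B∣ k≤∣B∣+∣X∣
      with ⊆-of-size (k ∸ ∣ B ∣) X (m≤n+o⇒m∸n≤o k ∣ B ∣ k≤∣B∣+∣X∣)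
    ... | Y , Y⊆X , ∣Y∣≡k∸∣B∣ =
      S , (k≤∣S∣ , Λ≢⊤ k G S (≤-<-trans (deg-of-A a∈A) k∸∣B∣<k)) ,
      l[n∸c]≤[n+c]s ∣ Λ k G S ∣ (∣p∣≤n X) ∣ΛS∣≤∣X∣+∣B∣ n∸∣X∣≤∣B∣+∣B∣ (∣p∣≤∣p∪q∣ B Y)
      where
      S = B ∪ Y

      B∩Y=∅ : Empty (B ∩ Y)
      B∩Y=∅ (x , x∈B∩Y) with x∈p∩q⁻ B Y x∈B∩Y
      ... | x∈B , x∈Y = B-avoids-X x∈B (Y⊆X x∈Y)

      k≤∣S∣ : k ≤ ∣ S ∣
      k≤∣S∣ = subst (k ≤_) (sym (trans (∣p∪q∣≡∣p∣+∣q∣ B Y B∩Y=∅) (cong (∣ B ∣ +_) ∣Y∣≡k∸∣B∣)))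
                (m≤n+m∸n k ∣ B ∣)

      k∸∣B∣<k : k ∸ ∣ B ∣ < k
      k∸∣B∣<k = m∸n<m 0<k (≤-<-trans z≤n (x∈p⇒∣p-x∣<∣p∣ b∈B))

      deg-of-A : ∀ {x} → x ∈ A → degIn G S x ≤ k ∸ ∣ B ∣
      deg-of-A {x} x∈A = subst (degIn G S x ≤_) ∣Y∣≡k∸∣B∣ (degIn-≤ G S nbr∈Y)
        where
        nbr∈Y : ∀ {u} → u ∈ S → adj G x u ≡ true → u ∈ Y
        nbr∈Y {u} u∈S xu with x∈p∪q⁻ B Y u∈S
        ... | inj₂ u∈Y = u∈Y
        ... | inj₁ u∈B with () ← trans (sym xu) (no-edge x∈A u∈B)

      ΛS⊆X∪B : Λ k G S ⊆ X ∪ B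
      ΛS⊆X∪B {w} w∈ΛS with covers w
      ... | inj₁ w∈X        = x∈p∪q⁺ (inj₁ w∈X)
      ... | inj₂ (inj₂ w∈B) = x∈p∪q⁺ (inj₂ w∈B)
      ... | inj₂ (inj₁ w∈A) =
        contradiction (∈Λ⁻ k G S w∈ΛS) (<⇒≱ (≤-<-trans (deg-of-A w∈A) k∸∣B∣<k))

      ∣ΛS∣≤∣X∣+∣B∣ : ∣ Λ k G S ∣ ≤ ∣ X ∣ + ∣ B ∣
      ∣ΛS∣≤∣X∣+∣B∣ = ≤-trans (p⊆q⇒∣p∣≤∣q∣ ΛS⊆X∪B) (∣p∪q∣≤∣p∣+∣q∣ X B)

      n∸∣X∣≤∣B∣+∣B∣ : n ∸ ∣ X ∣ ≤ ∣ B ∣ + ∣ B ∣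
      n∸∣X∣≤∣B∣+∣B∣ = ≤-trans n∸∣X∣≤∣A∣+∣B∣ (+-monoˡ-≤ ∣ B ∣ ∣A∣≤∣B∣)

    lowExpansion-if-∣A∣≤∣B∣ : ∀ {k} → 0 < k → k ≤ n → ∣ A ∣ ≤ ∣ B ∣ → LowExpansionSet k G ∣ X ∣
    lowExpansion-if-∣A∣≤∣B∣ {k} 0<k k≤n ∣A∣≤∣B∣ with k ≤? ∣ B ∣ + ∣ X ∣
    ... | yes k≤∣B∣+∣X∣ = lowExpansion-if-k≤∣B∣+∣X∣ 0<k ∣A∣≤∣B∣ k≤∣B∣+∣X∣
    ... | no  k≰∣B∣+∣X∣ = lowExpansion-if-∣B∣+∣X∣<k k≤n (≰⇒> k≰∣B∣+∣X∣)

  separation⇒lowExpansion : ∀ {n k} {G : Graph n} {X} →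
                            0 < k → k ≤ n → Separation G X → LowExpansionSet k G ∣ X ∣
  separation⇒lowExpansion 0<k k≤n s with ≤-total ∣ Separation.A s ∣ ∣ Separation.B s ∣
  ... | inj₁ ∣A∣≤∣B∣ = lowExpansion-if-∣A∣≤∣B∣ s 0<k k≤n ∣A∣≤∣B∣
  ... | inj₂ ∣B∣≤∣A∣ = lowExpansion-if-∣A∣≤∣B∣ (swap s) 0<k k≤n ∣B∣≤∣A∣

  Reach-∉ : ∀ {n} {G : Graph n} {X u w} → Reach G X u w → w ∉ X
  Reach-∉ (here u∉X)     = u∉X
  Reach-∉ (step _ _ w∉X) = w∉X

  module _ {n} {G : Graph n} {X : Subset n} {u} (reach? : ∀ w → Dec (Reach G X u w)) where

    Reachable : Subset n
    Reachable = tabulate (λ w → does (reach? w))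

    ∈Reachable⁻ : ∀ {w} → w ∈ Reachable → Reach G X u w
    ∈Reachable⁻ {w} w∈R with reach? w | ∈tabulate⁻ w∈R
    ... | yes u⇝w | _  = u⇝w
    ... | no _    | ()

    ∈Reachable⁺ : ∀ {w} → Reach G X u w → w ∈ Reachable
    ∈Reachable⁺ {w} u⇝w = ∈tabulate⁺ (dec-true (reach? w) u⇝w)

    Unreached : Subset n
    Unreached = ∁ (X ∪ Reachable)

    Unreached-avoids-X : ∀ {w} → w ∈ Unreached → w ∉ X
    Unreached-avoids-X w∈U w∈X = x∈∁p⇒x∉p w∈U (x∈p∪q⁺ (inj₁ w∈X))

    no-edge-Reachable-Unreached : ∀ {x y} → x ∈ Reachable → y ∈ Unreached → adj G x y ≡ false
    no-edge-Reachable-Unreached {x} {y} x∈R y∈U with adj G x y in xy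
    ... | false = refl
    ... | true  = contradiction (x∈p∪q⁺ (inj₂ (∈Reachable⁺ (step (∈Reachable⁻ x∈R) xy y∉X))))
                                (x∈∁p⇒x∉p y∈U)
      where
      y∉X : y ∉ X
      y∉X = Unreached-avoids-X y∈U

    component-separation : u ∉ X → ∀ {v} → v ∉ X → ¬ Reach G X u v → Separation G X
    component-separation u∉X {v} v∉X ¬u⇝v = record
      { A = Reachable ; B = Unreached ; a = u ; b = v
      ; a∈A = ∈Reachable⁺ (here u∉X)
      ; b∈B = x∉p⇒x∈∁p ([ v∉X , ¬u⇝v ∘ ∈Reachable⁻ ]′ ∘ x∈p∪q⁻ X Reachable)
      ; A-avoids-X = Reach-∉ ∘ ∈Reachable⁻
      ; B-avoids-X = Unreached-avoids-X
      ; covers = covers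
      ; no-edge = no-edge-Reachable-Unreached
      }
      where
      covers : ∀ w → w ∈ X ⊎ w ∈ Reachable ⊎ w ∈ Unreached
      covers w with w ∈? X ∪ Reachable
      ... | yes w∈X∪R = Sum.map₂ inj₁ (x∈p∪q⁻ X Reachable w∈X∪R)
      ... | no  w∉X∪R = inj₂ (inj₂ (x∉p⇒x∈∁p w∉X∪R))

  -- Reachability in G - X is decidable only through a graph search; under a double negation
  -- excluded middle provides it instead, and the main goal, a decidable inequality, is stable.
  separating⇒¬¬lowExpansion : ∀ {n k} {G : Graph n} {X S} → 0 < k → Admissible k G S →
                              Separating G X → ¬ ¬ LowExpansionSet k G ∣ X ∣
  separating⇒¬¬lowExpansion {n} {G = G} {X} {S} 0<k adm@(k≤∣S∣ , _) (inj₁ ∣∁X∣≤1) =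
    contradiction (lowExpansion-if-n∸c≤∣S∣ G ∣ X ∣ S adm n∸∣X∣≤∣S∣)
    where
    n∸∣X∣≤∣S∣ : n ∸ ∣ X ∣ ≤ ∣ S ∣
    n∸∣X∣≤∣S∣ = ≤-trans (subst (_≤ 1) (∣∁p∣≡n∸∣p∣ X) ∣∁X∣≤1) (≤-trans 0<k k≤∣S∣)
  separating⇒¬¬lowExpansion {G = G} {X} {S} 0<k (k≤∣S∣ , _) (inj₂ (u , v , u∉X , v∉X , ¬u⇝v)) =
    ¬¬-map (λ reach? → separation⇒lowExpansion 0<k k≤n (component-separation reach? u∉X v∉X ¬u⇝v))
           (sequence (RawMonad.rawApplicative ¬¬-Monad) (λ w → ¬¬-excluded-middle))
    where
    k≤n = ≤-trans k≤∣S∣ (∣p∣≤n S)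

open Expansion using (LowExpansionSet; separating⇒¬¬lowExpansion)
open NatToRational using (≤ratio⇒*ι≤ι; [b-1]n≤[b+1]c)
open import Data.Nat using (ℕ; _≤_)
open import Data.Integer using (+_)
open import Data.Rational using (ℚ; 1ℚ; _+_; _-_; _*_; _/_) renaming (_≤_ to _≤ℚ_)
open import Data.Nat as ℕ using (_<_; z≤n; s≤s)
open import Data.Nat.Properties using (≤-trans; <-≤-trans)
open import Data.Rational.Properties as ℚ using (_≤?_; positive⁻¹)
open import Data.Fin.Subset using (∣_∣)
open import Data.Fin.Subset.Properties using (∣p∣≤n)
open import Data.Empty using (⊥-elim)
open import Data.Product using (_,_)
open import Data.Sum using (inj₁; inj₂)
open import Relation.Nullary.Decidable using (decidable-stable)
open import Relation.Nullary.Negation using (¬¬-map)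
open import Relation.Binary.PropositionalEquality using (refl)

proposition2p9 : (k : ℕ) → 2 ≤ k → (n : ℕ) → (G : Graph n) → (b : ℚ) → (c : ℕ)
    → IsBeta k G b → IsKappa G c → 1ℚ ≤ℚ b
    → (b - 1ℚ) * ((+ n) / 1) ≤ℚ (b + 1ℚ) * ((+ c) / 1)
proposition2p9 _ _ _ _ _ _ (inj₁ (_ , refl)) _ 1≤0 =
  -- the bound holds for every b; 1 ≤ b only rules out the convention b = 0 for n < k
  ⊥-elim (ℚ.<-irrefl refl (ℚ.<-≤-trans (positive⁻¹ 1ℚ) 1≤0))
proposition2p9 k 2≤k n G b _ (inj₂ (_ , (S₀ , S₀-adm , _) , b-minimal)) ((X , X-separating , refl) , _) _ =
  decidable-stable (_ ≤? _) (¬¬-map bound (separating⇒¬¬lowExpansion {S = S₀} 0<k S₀-adm X-separating))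
  where
  0<k : 0 < k
  0<k = ≤-trans (s≤s z≤n) 2≤k
  bound : LowExpansionSet k G ∣ X ∣ → (b - 1ℚ) * ((+ n) / 1) ≤ℚ (b + 1ℚ) * ((+ ∣ X ∣) / 1)
  bound (S , S-adm@(k≤∣S∣ , _) , expansion≤) = [b-1]n≤[b+1]c b (∣p∣≤n X)
    (≤ratio⇒*ι≤ι ∣ Λ k G S ∣ (n ℕ.∸ ∣ X ∣) (n ℕ.+ ∣ X ∣) (<-≤-trans 0<k k≤∣S∣)
                 (b-minimal S S-adm) expansion≤)
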